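{- Let $A$ be a nonempty set. (1) If $R\subseteq\mathrm{Rel}(A)$ satisfies $R=\mathrm{sInv}\,\mathrm{Aut}\,R$, then $R$ is $\bigcap$-closed and closed under all invariant operations with countable arity, i.e. $R=\langle R\rangle_{\omega\text{ - }inv,\bigcap}$. (2) If $Q\subseteq\mathrm{Rel}(A)$ is countable or finite, then $\langle Q\rangle_{\omega\text{ - }inv}=\mathrm{sInv}\,\mathrm{Aut}\,Q$.
   Context: $\mathrm{Rel}^{(m)}(A)$ is the set of subsets of $A^m$, $\mathrm{Rel}(A)=\bigcup_{m\ge1}\mathrm{Rel}^{(m)}(A)$. For a permutation $g$ of $A$, $g[\varrho]=\{(g(a_1),\dots,g(a_m))\mid(a_1,\dots,a_m)\in\varrho\}$. $\mathrm{Aut}\,Q$ is the set of permutations $g$ of $A$ with $g[\varrho]=\varrho$ for all $\varrho\in Q$; $\mathrm{sInv}\,G$ is the set of $\varrho\in\mathrm{Rel}(A)$ with $g[\varrho]=\varrho$ for all $g\in G$. An invariant operation with countable arity is a map $F:\prod_{1\le i\in\omega}\mathrm{Rel}^{(m_i)}(A)\to\mathrm{Rel}^{(m)}(A)$ ($m_i,m\ge1$) such that $F((g[\varrho_i])_{i\ge1})=g[F((\varrho_i)_{i\ge1})]$ for all permutations $g$ of $A$ and all $(\varrho_i)_i$. $\langle Q\rangle_{\omega\text{ - }inv}$ is the closure of $Q$ under all invariant operations with countable arity, and $\langle Q\rangle_{\omega\text{ - }inv,\bigcap}$ is the least set of relations containing $Q$, closed under these operations, containing $A^m$ for all $m\ge1$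 and closed under arbitrary intersections of relations of the same arity. A set is $\bigcap$-closed if it contains all $A^m$ and is closed under arbitrary intersections of relations of the same arity. -}

module Defs where

open import Level using (Level; suc; _⊔_)
open import Data.Nat using (ℕ) renaming (suc to 1+)
open import Data.Vec using (Vec; map)
open import Data.Unit.Polymorphic using (⊤)
open import Data.Product using (Σ; _×_; ∃)
open import Function.Bundles using (_↔_; Inverse)
open import Relation.Binary.PropositionalEquality using (_≡_)

-- ARITY CONVENTION: the index m : ℕ stands for arity (m + 1), so that all arities are ≥ 1.
-- Rel A m  =  Rel^(m+1)(A)  =  subsets of A^(m+1)
Rel : ∀ {ℓ} → Set ℓ → ℕ → Set (suc ℓ)
Rel {ℓ} A m = Vec A (1+ m) → Set ℓ

_≐_ : ∀ {ℓ} {A : Set ℓ} {m : ℕ} → Rel A m → Rel A m → Set ℓ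
ρ ≐ σ = ∀ x → (ρ x → σ x) × (σ x → ρ x)

RelSet : ∀ {ℓ} → Set ℓ → Set (suc (suc ℓ))
RelSet {ℓ} A = (m : ℕ) → Rel A m → Set (suc ℓ)

_≋_ : ∀ {ℓ} {A : Set ℓ} → RelSet A → RelSet A → Set (suc ℓ)
R ≋ S = ∀ m ρ → (R m ρ → S m ρ) × (S m ρ → R m ρ)

Perm : ∀ {ℓ} → Set ℓ → Set ℓ
Perm A = A ↔ A

_[_] : ∀ {ℓ} {A : Set ℓ} {m : ℕ} → Perm A → Rel A m → Rel A m
(g [ ρ ]) y = ∃ λ x → ρ x × map (Inverse.to g) x ≡ y

Aut : ∀ {ℓ} {A : Set ℓ} → RelSet A → Perm A → Set (suc ℓ)
Aut Q g = ∀ m ρ → Q m ρ → (g [ ρ ]) ≐ ρ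

sInv : ∀ {ℓ} {A : Set ℓ} → (Perm A → Set (suc ℓ)) → RelSet A
sInv G m ρ = ∀ g → G g → (g [ ρ ]) ≐ ρ

-- invariant operation with countable arity:
--   F : ∏_{i ∈ ω} Rel^(ms i + 1)(A) → Rel^(m + 1)(A)
-- F is required to be a function on relations-as-sets, i.e. to respect ≐ (extensionality),
-- and to commute with every permutation g.
IsInvOp : ∀ {ℓ} {A : Set ℓ} {ms : ℕ → ℕ} {m : ℕ} →
          (((i : ℕ) → Rel A (ms i)) → Rel A m) → Set (suc ℓ)
IsInvOp {A = A} {ms} F =
  ((σs τs : (i : ℕ) → Rel A (ms i)) → (∀ i → σs i ≐ τs i) → F σs ≐ F τs)
  × ((g : Perm A) (σs : (i : ℕ) → Rel A (ms i)) → F (λ i → g [ σs i ]) ≐ (g [ F σs ]))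

InvOpClosed : ∀ {ℓ} {A : Set ℓ} → RelSet A → Set (suc ℓ)
InvOpClosed {A = A} R =
  (ms : ℕ → ℕ) (m : ℕ) (F : ((i : ℕ) → Rel A (ms i)) → Rel A m) → IsInvOp F →
  (σs : (i : ℕ) → Rel A (ms i)) → (∀ i → R (ms i) (σs i)) → R m (F σs)

Full : ∀ {ℓ} {A : Set ℓ} (m : ℕ) → Rel A m
Full {ℓ} m x = ⊤ {ℓ}

⋂ : ∀ {ℓ} {A : Set ℓ} {m : ℕ} {I : Set ℓ} → (I → Rel A m) → Rel A m
⋂ σs x = ∀ i → σs i x

IntersectionClosed : ∀ {ℓ} {A : Set ℓ} → RelSet A → Set (suc ℓ)
IntersectionClosed {ℓ} {A} R =
  ((m : ℕ) → R m (Full m))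
  × ((m : ℕ) (I : Set ℓ) (σs : I → Rel A m) → (∀ i → R m (σs i)) → R m (⋂ σs))

-- ⟨Q⟩_{ω-inv}: least set containing Q and closed under invariant operations with countable
-- arity (membership taken up to ≐, since subsets of A^m are compared extensionally)
data ⟨_⟩ω-inv {ℓ} {A : Set ℓ} (Q : RelSet A) : RelSet A where
  base : ∀ {m} {ρ σ : Rel A m} → Q m ρ → ρ ≐ σ → ⟨ Q ⟩ω-inv m σ
  op   : ∀ {ms : ℕ → ℕ} {m} (F : ((i : ℕ) → Rel A (ms i)) → Rel A m) → IsInvOp F →
         (σs : (i : ℕ) → Rel A (ms i)) → (∀ i → ⟨ Q ⟩ω-inv (ms i) (σs i)) →
         {ρ : Rel A m} → F σs ≐ ρ → ⟨ Q ⟩ω-inv m ρ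

data ⟨_⟩ω-inv⋂ {ℓ} {A : Set ℓ} (Q : RelSet A) : RelSet A where
  base : ∀ {m} {ρ σ : Rel A m} → Q m ρ → ρ ≐ σ → ⟨ Q ⟩ω-inv⋂ m σ
  op   : ∀ {ms : ℕ → ℕ} {m} (F : ((i : ℕ) → Rel A (ms i)) → Rel A m) → IsInvOp F →
         (σs : (i : ℕ) → Rel A (ms i)) → (∀ i → ⟨ Q ⟩ω-inv⋂ (ms i) (σs i)) →
         {ρ : Rel A m} → F σs ≐ ρ → ⟨ Q ⟩ω-inv⋂ m ρ
  full : ∀ {m} {ρ : Rel A m} → Full m ≐ ρ → ⟨ Q ⟩ω-inv⋂ m ρ
  meet : ∀ {m} (I : Set ℓ) (σs : I → Rel A m) → (∀ i → ⟨ Q ⟩ω-inv⋂ m (σs i)) →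
         {ρ : Rel A m} → ⋂ σs ≐ ρ → ⟨ Q ⟩ω-inv⋂ m ρ

-- the set {qs i | i ∈ ω} enumerated by a sequence of relations (arity ar i + 1)
-- (a nonempty set of relations is countable or finite iff it has such an enumeration)
data Enum {ℓ} {A : Set ℓ} (ar : ℕ → ℕ) (qs : (i : ℕ) → Rel A (ar i)) : RelSet A where
  mem : ∀ i {ρ : Rel A (ar i)} → qs i ≐ ρ → Enum ar qs (ar i) ρ

{-# OPTIONS --safe #-}
-- Both parts rest on the Galois connection between Aut and sInv.  Every sInv G
-- contains the full relations and is closed under intersections and invariant
-- operations, so it contains the closure of any of its subsets; this gives (1)
-- and one inclusion of (2).  Conversely, if ρ is invariant under Aut Q for
-- Q = {q₀, q₁, …}, then F (σ₀, σ₁, …) := ⋃ { g[ρ] | g[qᵢ] = σᵢ for all i } is an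
-- invariant operation of countable arity with F (q₀, q₁, …) = ρ: the permutations
-- fixing every qᵢ are exactly Aut Q, and they fix ρ.
module Submission where

open import Defs
open import Level using (Level)
open import Data.Nat using (ℕ)
open import Data.Product using (_×_; _,_; proj₁; proj₂; Σ)
open import Data.Unit.Polymorphic using (tt)
open import Data.Vec using (Vec; map)
open import Data.Vec.Properties using (map-∘; map-id; map-cong)
open import Function.Bundles using (Inverse)
open import Function.Construct.Composition using (_↔-∘_)
open import Function.Construct.Identity using (↔-id)
open import Function.Construct.Symmetry using (↔-sym)
open import Relation.Binary.PropositionalEquality using (_≡_; refl; sym; trans; subst)

module _ {ℓ : Level} {A : Set ℓ} where

  open Inverse

  private variable
    m : ℕ
    ρ σ τ : Rel A m

  map-from-to : (g : Perm A) {n : ℕ} (x : Vec A n) → map (from g) (map (to g) x) ≡ x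
  map-from-to g x = trans (sym (map-∘ (from g) (to g) x))
                          (trans (map-cong (strictlyInverseʳ g) x) (map-id x))

  map-to-from : (g : Perm A) {n : ℕ} (x : Vec A n) → map (to g) (map (from g) x) ≡ x
  map-to-from g = map-from-to (↔-sym g)

  _⊆_ : Rel A m → Rel A m → Set ℓ
  ρ ⊆ σ = ∀ x → ρ x → σ x

  ≐⇒⊆ : ρ ≐ σ → ρ ⊆ σ
  ≐⇒⊆ e x = proj₁ (e x)

  ≐-refl : ρ ≐ ρ
  ≐-refl x = (λ p → p) , (λ p → p)

  ≐-sym : ρ ≐ σ → σ ≐ ρ
  ≐-sym e x = proj₂ (e x) , proj₁ (e x)

  ≐-trans : ρ ≐ σ → σ ≐ τ → ρ ≐ τ
  ≐-trans e f x = (λ p → proj₁ (f x) (proj₁ (e x) p)) , (λ p → proj₂ (e x) (proj₂ (f x) p))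

  []-elim : (g : Perm A) {y : Vec A _} → (g [ ρ ]) y → ρ (map (from g) y)
  []-elim {ρ = ρ} g (x , p , refl) = subst ρ (sym (map-from-to g x)) p

  []-intro : (g : Perm A) {y : Vec A _} → ρ (map (from g) y) → (g [ ρ ]) y
  []-intro g {y} p = map (from g) y , p , map-to-from g y

  []-mono : (g : Perm A) → ρ ⊆ σ → (g [ ρ ]) ⊆ (g [ σ ])
  []-mono g ρ⊆σ y (x , p , e) = x , ρ⊆σ x p , e

  []-cong : (g : Perm A) → ρ ≐ σ → (g [ ρ ]) ≐ (g [ σ ])
  []-cong g e y = []-mono g (≐⇒⊆ e) y , []-mono g (≐⇒⊆ (≐-sym e)) y

  []-id : (↔-id A [ ρ ]) ≐ ρ
  []-id {ρ = ρ} y = (λ p → subst ρ (map-id y) ([]-elim (↔-id A) p))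
                  , (λ p → []-intro (↔-id A) (subst ρ (sym (map-id y)) p))

  []-∘ : (g h : Perm A) → ((g ↔-∘ h) [ ρ ]) ≐ (g [ h [ ρ ] ])
  []-∘ {ρ = ρ} g h y =
    (λ p → []-intro g ([]-intro h (subst ρ (map-∘ (from h) (from g) y) ([]-elim (g ↔-∘ h) p))))
    , (λ p → []-intro (g ↔-∘ h) (subst ρ (sym (map-∘ (from h) (from g) y)) ([]-elim h ([]-elim g p))))

  []-inverseˡ : (g : Perm A) → (↔-sym g [ g [ ρ ] ]) ≐ ρ
  []-inverseˡ {ρ = ρ} g y =
    (λ p → subst ρ (map-from-to g y) ([]-elim g ([]-elim (↔-sym g) p)))
    , (λ p → []-intro (↔-sym g) ([]-intro g (subst ρ (sym (map-from-to g y)) p)))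

  []-inverseʳ : (g : Perm A) → (g [ ↔-sym g [ ρ ] ]) ≐ ρ
  []-inverseʳ g = []-inverseˡ (↔-sym g)

  []-Full : (g : Perm A) → (g [ Full m ]) ≐ Full m
  []-Full g y = (λ _ → tt) , (λ _ → []-intro g tt)

  []-⋂ : (g : Perm A) {I : Set ℓ} (σs : I → Rel A m) →
         (∀ i → (g [ σs i ]) ≐ σs i) → (g [ ⋂ σs ]) ≐ ⋂ σs
  []-⋂ g σs fixed y = (λ p i → proj₁ (fixed i y) ([]-intro g ([]-elim g p i)))
                    , (λ p → []-intro g (λ i → []-elim g (proj₂ (fixed i y) (p i))))

  _⊑_ : RelSet A → RelSet A → Set (Level.suc ℓ)
  R ⊑ S = ∀ {m ρ} → R m ρ → S m ρ

  ⊑-antisym : {R S : RelSet A} → R ⊑ S → S ⊑ R → R ≋ S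
  ⊑-antisym R⊑S S⊑R m ρ = R⊑S , S⊑R

  ⊑-sInv-Aut : (Q : RelSet A) → Q ⊑ sInv (Aut Q)
  ⊑-sInv-Aut Q q g g∈Aut = g∈Aut _ _ q

  ω-inv⊑ω-inv⋂ : (Q : RelSet A) → ⟨ Q ⟩ω-inv ⊑ ⟨ Q ⟩ω-inv⋂
  ω-inv⊑ω-inv⋂ Q (base q e)          = base q e
  ω-inv⊑ω-inv⋂ Q (op F isF σs σs∈ e) = op F isF σs (λ i → ω-inv⊑ω-inv⋂ Q (σs∈ i)) e

  module _ (G : Perm A → Set (Level.suc ℓ)) where

    sInv-resp-≐ : sInv G m ρ → ρ ≐ σ → sInv G m σ
    sInv-resp-≐ ρ∈ e g g∈G = ≐-trans ([]-cong g (≐-sym e)) (≐-trans (ρ∈ g g∈G) e)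

    sInv-IntersectionClosed : IntersectionClosed (sInv G)
    sInv-IntersectionClosed = (λ m g _ → []-Full g)
                            , (λ m I σs σs∈ g g∈G → []-⋂ g σs (λ i → σs∈ i g g∈G))

    sInv-InvOpClosed : InvOpClosed (sInv G)
    sInv-InvOpClosed ms m F (F-cong , F-inv) σs σs∈ g g∈G =
      ≐-trans (≐-sym (F-inv g σs)) (F-cong _ σs (λ i → σs∈ i g g∈G))

    ω-inv⋂⊑sInv : {Q : RelSet A} → Q ⊑ sInv G → ⟨ Q ⟩ω-inv⋂ ⊑ sInv G
    ω-inv⋂⊑sInv Q⊑ (base q e) = sInv-resp-≐ (Q⊑ q) e
    ω-inv⋂⊑sInv Q⊑ (op F isF σs σs∈ e) =
      sInv-resp-≐ (sInv-InvOpClosed _ _ F isF σs (λ i → ω-inv⋂⊑sInv Q⊑ (σs∈ i))) e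
    ω-inv⋂⊑sInv Q⊑ (full e) = sInv-resp-≐ (proj₁ sInv-IntersectionClosed _) e
    ω-inv⋂⊑sInv Q⊑ (meet I σs σs∈ e) =
      sInv-resp-≐ (proj₂ sInv-IntersectionClosed _ I σs (λ i → ω-inv⋂⊑sInv Q⊑ (σs∈ i))) e

  sInvAut-fixed⇒closed : (R : RelSet A) → R ≋ sInv (Aut R) →
    IntersectionClosed R × InvOpClosed R × (R ≋ ⟨ R ⟩ω-inv⋂)
  sInvAut-fixed⇒closed R R≋ =
      ( (λ m → from-sInv (proj₁ (sInv-IntersectionClosed G) m))
      , (λ m I σs σs∈ → from-sInv (proj₂ (sInv-IntersectionClosed G) m I σs (λ i → to-sInv (σs∈ i)))) )
    , (λ ms m F isF σs σs∈ → from-sInv (sInv-InvOpClosed G ms m F isF σs (λ i → to-sInv (σs∈ i))))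
    , ⊑-antisym (λ ρ∈ → base ρ∈ ≐-refl) (λ ρ∈ → from-sInv (ω-inv⋂⊑sInv G to-sInv ρ∈))
    where
      G = Aut R
      to-sInv : R ⊑ sInv G
      to-sInv {m} {ρ} = proj₁ (R≋ m ρ)
      from-sInv : sInv G ⊑ R
      from-sInv {m} {ρ} = proj₂ (R≋ m ρ)

  module _ (ar : ℕ → ℕ) (qs : (i : ℕ) → Rel A (ar i)) where

    Sends : Perm A → ((i : ℕ) → Rel A (ar i)) → Set ℓ
    Sends g σs = ∀ i → (g [ qs i ]) ≐ σs i

    Sends⇒Aut : (g : Perm A) → Sends g qs → Aut (Enum ar qs) g
    Sends⇒Aut g g-fixes _ _ (mem i e) = ≐-trans ([]-cong g (≐-sym e)) (≐-trans (g-fixes i) e)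

    Sends-∘ : (h g : Perm A) {σs : (i : ℕ) → Rel A (ar i)} →
              Sends g σs → Sends (h ↔-∘ g) (λ i → h [ σs i ])
    Sends-∘ h g g-sends i = ≐-trans ([]-∘ h g) ([]-cong h (g-sends i))

    orbitOp : Rel A m → ((i : ℕ) → Rel A (ar i)) → Rel A m
    orbitOp ρ σs y = Σ (Perm A) λ g → Sends g σs × (g [ ρ ]) y

    orbitOp-cong : (σs τs : (i : ℕ) → Rel A (ar i)) → (∀ i → σs i ≐ τs i) →
                   orbitOp ρ σs ≐ orbitOp ρ τs
    orbitOp-cong σs τs e y =
        (λ (g , g-sends , p) → g , (λ i → ≐-trans (g-sends i) (e i)) , p)
      , (λ (g , g-sends , p) → g , (λ i → ≐-trans (g-sends i) (≐-sym (e i))) , p)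

    orbitOp-invariant : (h : Perm A) (σs : (i : ℕ) → Rel A (ar i)) →
                        orbitOp ρ (λ i → h [ σs i ]) ≐ (h [ orbitOp ρ σs ])
    orbitOp-invariant {ρ = ρ} h σs y = forward , backward
      where
        forward : orbitOp ρ (λ i → h [ σs i ]) y → (h [ orbitOp ρ σs ]) y
        forward (g , g-sends , p) =
          []-mono h (λ x q → h⁻¹g , h⁻¹g-sends , q) y
            (≐⇒⊆ ([]-cong h (≐-sym ([]-∘ (↔-sym h) g))) y (≐⇒⊆ (≐-sym ([]-inverseʳ h)) y p))
          where
            h⁻¹g = ↔-sym h ↔-∘ g
            h⁻¹g-sends : Sends h⁻¹g σs
            h⁻¹g-sends i = ≐-trans (Sends-∘ (↔-sym h) g g-sends i) ([]-inverseˡ h)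

        backward : (h [ orbitOp ρ σs ]) y → orbitOp ρ (λ i → h [ σs i ]) y
        backward (x , (g , g-sends , p) , e) =
          h ↔-∘ g , Sends-∘ h g g-sends , ≐⇒⊆ (≐-sym ([]-∘ h g)) y (x , p , e)

    orbitOp-qs : sInv (Aut (Enum ar qs)) m ρ → orbitOp ρ qs ≐ ρ
    orbitOp-qs ρ∈ y = (λ (g , g-fixes , p) → ≐⇒⊆ (ρ∈ g (Sends⇒Aut g g-fixes)) y p)
                    , (λ p → ↔-id A , (λ i → []-id) , ≐⇒⊆ (≐-sym []-id) y p)

    ⟨Enum⟩ω-inv≋sInvAut : ⟨ Enum ar qs ⟩ω-inv ≋ sInv (Aut (Enum ar qs))
    ⟨Enum⟩ω-inv≋sInvAut = ⊑-antisym
      (λ ρ∈ → ω-inv⋂⊑sInv (Aut Q) (⊑-sInv-Aut Q) (ω-inv⊑ω-inv⋂ Q ρ∈))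
      (λ {_} {ρ} ρ∈ → op (orbitOp ρ) (orbitOp-cong , orbitOp-invariant) qs
                         (λ i → base (mem i ≐-refl) ≐-refl) (orbitOp-qs ρ∈))
      where Q = Enum ar qs

lemma4p4 : ∀ {ℓ : Level} (A : Set ℓ) → A →
    ((R : RelSet A) → R ≋ sInv (Aut R) →
       IntersectionClosed R × InvOpClosed R × (R ≋ ⟨ R ⟩ω-inv⋂))
    × ((ar : ℕ → ℕ) (qs : (i : ℕ) → Rel A (ar i)) →
       ⟨ Enum ar qs ⟩ω-inv ≋ sInv (Aut (Enum ar qs)))
lemma4p4 A _ = sInvAut-fixed⇒closed , ⟨Enum⟩ω-inv≋sInvAut
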